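{- Let $h(x)$ be a polynomial with real coefficients. For integers $n\ge0$ and $l$ put $F_{h,n}^l(x)=\sum_{i=0}^{l}\binom{n-1-i}{i}h^{n-2i-1}(x)$ (so $F_{h,n}^l(x)=0$ when $l<0$), and for $n\ge1$, $0\le l\le\lfloor n/2\rfloor$ put $L_{h,n}^l(x)=\sum_{i=0}^{l}\frac{n}{n-i}\binom{n-i}{i}h^{n-2i}(x)$. Then for every integer $n\ge1$ and $0\le l\le\lfloor n/2\rfloor$, $$L_{h,n}^{l}(x)=F_{h,n-1}^{l-1}(x)+F_{h,n+1}^{l}(x).$$
   Context: $h(x)$ is a polynomial with real coefficients; $h^k(x)$ denotes $(h(x))^k$. $F_{h,n}^l$ are the incomplete $h(x)$-Fibonacci polynomials and $L_{h,n}^l$ the incomplete $h(x)$-Lucas polynomials. An empty sum equals $0$. -}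

module Defs where

open import Level using (Level)
import Algebra.Bundles
open import Algebra.Bundles using (CommutativeRing)
open import Data.Nat as ℕ using (ℕ; zero; suc; _∸_)
open import Data.Nat.Combinatorics using (_C_)
open import Data.Nat.DivMod using (_/_)
open import Data.Integer as ℤ using (ℤ; +_; -[1+_])

-- Exact division helper: the paper's n/(n-i); division by 0 never occurs
-- in the range used (n ≥ 1, i ≤ ⌊n/2⌋ gives n - i ≥ 1).
_div_ : ℕ → ℕ → ℕ
a div zero    = 0
a div (suc b) = a / suc b

-- Coefficient n/(n-i) * binom(n-i, i) of the incomplete Lucas polynomial
-- (always a natural number, so this is exact).
lucasCoeff : ℕ → ℕ → ℕ
lucasCoeff n i = (n ℕ.* ((n ∸ i) C i)) div (n ∸ i)

module _ {c ℓ : Level} (R : CommutativeRing c ℓ) where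
  open CommutativeRing R
  open import Algebra.Definitions.RawSemiring (Algebra.Bundles.Semiring.rawSemiring semiring) using (_^_; _×_)

  sumTo : ℕ → (ℕ → Carrier) → Carrier
  sumTo zero    f = f 0
  sumTo (suc l) f = sumTo l f + f (suc l)

  -- incomplete h-Fibonacci polynomial F_{h,n}^l (evaluated: h is the value h(x));
  -- empty sum (l < 0) is 0.
  F : Carrier → ℕ → ℤ → Carrier
  F h n (+ l)    = sumTo l (λ i → ((n ∸ 1 ∸ i) C i) × (h ^ (n ∸ (2 ℕ.* i) ∸ 1)))
  F h n -[1+ _ ] = 0#

  L : Carrier → ℕ → ℕ → Carrier
  L h n l = sumTo l (λ i → lucasCoeff n i × (h ^ (n ∸ (2 ℕ.* i))))

{-# OPTIONS --safe #-}
module Submission where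

-- Induction on l: the i-th Lucas term splits into the i-th terms of F_{h,n+1} and F_{h,n-1}
-- because (n/(n-i)) C(n-i,i) = C(n-i,i) + C(n-i-1,i-1), which after multiplying by n - i
-- is the absorption identity i C(n-i,i) = (n-i) C(n-i-1,i-1).
-- The argument only needs l < n, which l ≤ ⌊n/2⌋ and n ≥ 1 imply.

open import Defs
open import Level using (Level)
open import Algebra.Bundles using (CommutativeRing)
import Algebra.Bundles
import Algebra.Properties.CommutativeSemigroup as CommSemigroupProperties
import Algebra.Properties.Semiring.Mult as SemiringMultProperties
import Relation.Binary.Reasoning.Setoid as SetoidReasoning
import Data.Nat as ℕ
open import Data.Nat using (ℕ; zero; suc; _∸_; _≤_; _<_; _/_; s≤s; z≤n)
open import Data.Nat.Properties using (m≤n⇒m≤1+n; ≤-<-trans)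
open import Data.Nat.DivMod using (m/n<m)
open import Data.Nat.Combinatorics using (_C_)
open import Data.Integer as ℤ using (+_)
open import Relation.Binary.PropositionalEquality using (_≡_; cong; cong₂)

module Arithmetic where
  open import Data.Nat using (_+_; _*_)
  open import Relation.Binary.PropositionalEquality using (refl; sym; trans; module ≡-Reasoning)
  open import Data.Nat.Properties
    using ( +-assoc; +-comm; +-identityʳ; +-suc; *-comm; *-identityʳ; *-zeroʳ; *-suc
          ; *-distribˡ-+; *-distribʳ-+; ∸-+-assoc; +-∸-assoc; m+[n∸m]≡n)
  open import Data.Nat.DivMod using (m*n/n≡m; n/n≡1)
  open import Data.Nat.Combinatorics using (nCk+nC[k+1]≡[n+1]C[k+1]; nC1≡n)

  [1+k]*[1+m]C[1+k]≡[1+m]*mCk : ∀ m k → suc k * (suc m C suc k) ≡ suc m * (m C k)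
  [1+k]*[1+m]C[1+k]≡[1+m]*mCk zero    zero    = refl
  [1+k]*[1+m]C[1+k]≡[1+m]*mCk zero    (suc k) = *-zeroʳ (suc (suc k))
  [1+k]*[1+m]C[1+k]≡[1+m]*mCk (suc m) zero    =
    trans (+-identityʳ _) (trans (nC1≡n (suc (suc m))) (sym (*-identityʳ _)))
  [1+k]*[1+m]C[1+k]≡[1+m]*mCk (suc m) (suc k) = begin
    suc (suc k) * (suc (suc m) C suc (suc k))
      ≡⟨ cong (suc (suc k) *_) (nCk+nC[k+1]≡[n+1]C[k+1] (suc m) (suc k)) ⟨
    suc (suc k) * (a + b)
      ≡⟨ *-distribˡ-+ (suc (suc k)) a b ⟩
    (a + suc k * a) + suc (suc k) * b
      ≡⟨ cong₂ (λ u v → (a + u) + v) ([1+k]*[1+m]C[1+k]≡[1+m]*mCk m k)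
                                      ([1+k]*[1+m]C[1+k]≡[1+m]*mCk m (suc k)) ⟩
    (a + suc m * (m C k)) + suc m * (m C suc k)
      ≡⟨ +-assoc a _ _ ⟩
    a + (suc m * (m C k) + suc m * (m C suc k))
      ≡⟨ cong (λ u → a + u) (*-distribˡ-+ (suc m) (m C k) (m C suc k)) ⟨
    a + suc m * (m C k + m C suc k)
      ≡⟨ cong (λ u → a + suc m * u) (nCk+nC[k+1]≡[n+1]C[k+1] m k) ⟩
    suc (suc m) * a ∎
    where
    open ≡-Reasoning
    a = suc m C suc k
    b = suc m C suc (suc k)

  lucasCoeff-numerator : ∀ i m →
    (suc i + suc m) * (suc m C suc i) ≡ (suc m C suc i + m C i) * suc m
  lucasCoeff-numerator i m = begin
    (suc i + suc m) * c
      ≡⟨ *-distribʳ-+ c (suc i) (suc m) ⟩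
    suc i * c + suc m * c
      ≡⟨ cong (_+ suc m * c) ([1+k]*[1+m]C[1+k]≡[1+m]*mCk m i) ⟩
    suc m * (m C i) + suc m * c
      ≡⟨ *-distribˡ-+ (suc m) (m C i) c ⟨
    suc m * (m C i + c)
      ≡⟨ *-comm (suc m) _ ⟩
    (m C i + c) * suc m
      ≡⟨ cong (_* suc m) (+-comm (m C i) c) ⟩
    (c + m C i) * suc m ∎
    where
    open ≡-Reasoning
    c = suc m C suc i

  lucasCoeff-zero : ∀ n → lucasCoeff (suc n) 0 ≡ 1
  lucasCoeff-zero n = trans (cong (_/ suc n) (*-identityʳ (suc n))) (n/n≡1 (suc n))

  lucasCoeff-suc : ∀ {i n} → i ≤ n →
    lucasCoeff (2 + n) (suc i) ≡ (suc n ∸ i) C suc i + (n ∸ i) C i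
  lucasCoeff-suc {i} {n} i≤n rewrite +-∸-assoc 1 i≤n = begin
    (2 + n) * c / suc m
      ≡⟨ cong (λ t → t * c / suc m) 2+n≡[1+i]+[1+m] ⟩
    (suc i + suc m) * c / suc m
      ≡⟨ cong (_/ suc m) (lucasCoeff-numerator i m) ⟩
    (c + m C i) * suc m / suc m
      ≡⟨ m*n/n≡m (c + m C i) (suc m) ⟩
    c + m C i ∎
    where
    open ≡-Reasoning
    m = n ∸ i
    c = suc m C suc i
    2+n≡[1+i]+[1+m] : 2 + n ≡ suc i + suc m
    2+n≡[1+i]+[1+m] = cong suc (trans (cong suc (sym (m+[n∸m]≡n i≤n))) (sym (+-suc i m)))

  m∸[1+n]∸1≡m∸[2+n] : ∀ m n → m ∸ suc n ∸ 1 ≡ m ∸ suc (suc n)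
  m∸[1+n]∸1≡m∸[2+n] m n = trans (∸-+-assoc m (suc n) 1) (cong (m ∸_) (+-comm (suc n) 1))

  m∸1∸2l∸1≡m∸2[1+l] : ∀ m l → m ∸ 1 ∸ 2 * l ∸ 1 ≡ m ∸ 2 * suc l
  m∸1∸2l∸1≡m∸2[1+l] m l = trans (cong (_∸ 1) (∸-+-assoc m 1 (2 * l)))
    (trans (m∸[1+n]∸1≡m∸[2+n] m (2 * l)) (cong (m ∸_) (sym (*-suc 2 l))))

  [1+m]∸2[1+l]∸1≡m∸2[1+l] : ∀ m l → suc m ∸ 2 * suc l ∸ 1 ≡ m ∸ 2 * suc l
  [1+m]∸2[1+l]∸1≡m∸2[1+l] m l = trans (cong (λ k → suc m ∸ k ∸ 1) (*-suc 2 l))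
    (trans (m∸[1+n]∸1≡m∸[2+n] m (2 * l)) (cong (m ∸_) (sym (*-suc 2 l))))

open Arithmetic

module _ {c ℓ : Level} (R : CommutativeRing c ℓ) (h : CommutativeRing.Carrier R) where
  open CommutativeRing R
  open import Algebra.Definitions.RawSemiring (Algebra.Bundles.Semiring.rawSemiring semiring)
    using (_^_; _×_)
  open SemiringMultProperties semiring using (×-homo-+)
  open CommSemigroupProperties +-commutativeSemigroup using (interchange)
  open SetoidReasoning setoid

  F-pred-suc : ∀ m l → F R h m (ℤ.pred (+ suc l))
    ≈ F R h m (ℤ.pred (+ l)) + ((m ∸ 1 ∸ l) C l) × (h ^ (m ∸ 2 ℕ.* l ∸ 1))
  F-pred-suc m zero    = sym (+-identityˡ _)
  F-pred-suc m (suc l) = refl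

  L≈F+F : ∀ n l → l < n → L R h n l ≈ F R h (n ∸ 1) (ℤ.pred (+ l)) + F R h (suc n) (+ l)
  L≈F+F (suc n) zero _ = begin
    lucasCoeff (suc n) 0 × (h ^ suc n)
      ≡⟨ cong (_× (h ^ suc n)) (lucasCoeff-zero n) ⟩
    1 × (h ^ suc n)
      ≈⟨ +-identityˡ _ ⟨
    0# + 1 × (h ^ suc n) ∎
  L≈F+F (suc (suc n)) (suc l) (s≤s (s≤s l≤n)) = begin
    L R h (suc (suc n)) l + lucasCoeff (suc (suc n)) (suc l) × y
      ≈⟨ +-cong (L≈F+F (suc (suc n)) l (s≤s (m≤n⇒m≤1+n l≤n)))
                (reflexive (cong (_× y) (lucasCoeff-suc l≤n))) ⟩
    (G + H) + (a ℕ.+ b) × y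
      ≈⟨ +-cong refl (trans (×-homo-+ y a b) (+-comm _ _)) ⟩
    (G + H) + (b × y + a × y)
      ≈⟨ interchange G H (b × y) (a × y) ⟩
    (G + b × y) + (H + a × y)
      ≡⟨ cong₂ (λ e e′ → (G + b × (h ^ e)) + (H + a × (h ^ e′)))
               (m∸1∸2l∸1≡m∸2[1+l] (suc (suc n)) l)
               ([1+m]∸2[1+l]∸1≡m∸2[1+l] (suc (suc n)) l) ⟨
    (G + b × (h ^ (suc n ∸ 2 ℕ.* l ∸ 1))) + (H + a × (h ^ (suc (suc (suc n)) ∸ 2 ℕ.* suc l ∸ 1)))
      ≈⟨ +-cong (sym (F-pred-suc (suc n) l)) refl ⟩
    F R h (suc n) (ℤ.pred (+ suc l)) + F R h (suc (suc (suc n))) (+ suc l) ∎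
    where
    y = h ^ (suc (suc n) ∸ 2 ℕ.* suc l)
    a = (suc n ∸ l) C suc l
    b = (n ∸ l) C l
    G = F R h (suc n) (ℤ.pred (+ l))
    H = F R h (suc (suc (suc n))) (+ l)

proposition9 : {c ℓ : Level} (R : CommutativeRing c ℓ) (h : CommutativeRing.Carrier R)
    (n l : ℕ) → 1 ≤ n → l ≤ n / 2 →
    CommutativeRing._≈_ R (L R h n l)
      (CommutativeRing._+_ R (F R h (n ∸ 1) (ℤ.pred (+ l))) (F R h (suc n) (+ l)))
proposition9 R h (suc n) l _ l≤n/2 =
  L≈F+F R h (suc n) l (≤-<-trans l≤n/2 (m/n<m (suc n) 2 (s≤s (s≤s z≤n))))
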